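{- For all PCoR* terms $t, s$ over $\Sigma$: $\mathsf{REL} \models t \le s$ if and only if $\mathsf{REL}_{\mathrm{pw} \le \mathrm{iw}(t)} \models t \le s$.
   Context: PCoR* terms over $\Sigma$: $t ::= a \mid 1 \mid 0 \mid \top \mid t;t \mid t+t \mid t\cap t \mid t^{\smile} \mid t^{*}$, $a\in\Sigma$. Intersection width: $\mathrm{iw}(u)=1$ for $u\in\Sigma\cup\{1,0,\top\}$; $\mathrm{iw}(t^{\smile})=\mathrm{iw}(t^{*})=\mathrm{iw}(t)$; $\mathrm{iw}(t;s)=\mathrm{iw}(t+s)=\max(\mathrm{iw}(t),\mathrm{iw}(s))$; $\mathrm{iw}(t\cap s)=\mathrm{iw}(t)+\mathrm{iw}(s)$. A structure $S$ is a non-empty set $|S|$ with $a^S\subseteq|S|^2$ for each $a\in\Sigma$; semantics $[\![a]\!]_S=a^S$, $[\![1]\!]_S$ = identity on $|S|$, $[\![0]\!]_S=\emptyset$, $[\![\top]\!]_S=|S|^2$, and $;,+,\cap,{}^{\smile},{}^{*}$ are composition, union, intersection, converse, reflexive-transitive closure. $\mathsf{REL}$ = all structures; $\mathcal C\models t\le s$ means $[\![t]\!]_S\subseteq[\![s]\!]_S$ for all $S\in\mathcal C$. A path decomposition of a finite structure $S$ is a sequence $(U_1,\dots,U_n)$ of subsets of $|S|$ with $\bigcup_iU_i=|S|$, every $(x,y)\in a^S$ contained in some $U_i$, and $U_i\cap U_k\subseteq U_j$ whenever $i\le j\le k$; its width is $\max_i(\#U_i-1)$; $\mathrm{pw}(S)$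 is the minimum width. $\mathsf{REL}_{\mathrm{pw}\le k}$ is the class of finite structures $S$ with $\mathrm{pw}(S)\le k$. -}

module Defs where

open import Data.Nat using (ℕ; zero; suc; _+_; _∸_; _⊔_; _≤_)
open import Data.Fin using (Fin)
import Data.Fin as F
open import Data.Fin.Subset using (Subset; _∈_; ∣_∣)
open import Data.Product using (Σ; ∃; _×_; _,_)
open import Data.Sum using (_⊎_)
open import Data.Empty using (⊥)
open import Data.Unit using (⊤)
open import Relation.Binary.PropositionalEquality using (_≡_)
open import Relation.Binary.Construct.Closure.ReflexiveTransitive using (Star)

data Term (Σ : Set) : Set where
  var  : Σ → Term Σ
  one  : Term Σ
  zer  : Term Σ
  top  : Term Σ
  _⨾_  : Term Σ → Term Σ → Term Σ
  _⊕_  : Term Σ → Term Σ → Term Σ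
  _⊓_  : Term Σ → Term Σ → Term Σ
  _˘   : Term Σ → Term Σ
  _⋆   : Term Σ → Term Σ

iw : ∀ {Σ} → Term Σ → ℕ
iw (var a) = 1
iw one = 1
iw zer = 1
iw top = 1
iw (t ⨾ s) = iw t ⊔ iw s
iw (t ⊕ s) = iw t ⊔ iw s
iw (t ⊓ s) = iw t + iw s
iw (t ˘) = iw t
iw (t ⋆) = iw t

-- A structure over Σ with carrier A: A is non-empty (witnessed by point),
-- and each letter a is interpreted as a binary relation on A.
record Structure (Σ : Set) (A : Set) : Set₁ where
  field
    point : A
    rel   : Σ → A → A → Set

open Structure public

⟦_⟧ : ∀ {Σ A} → Term Σ → Structure Σ A → A → A → Set
⟦ var a ⟧ S x y = rel S a x y
⟦ one ⟧ S x y = x ≡ y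
⟦ zer ⟧ S x y = ⊥
⟦ top ⟧ S x y = ⊤
⟦ t ⨾ s ⟧ S x y = ∃ λ z → ⟦ t ⟧ S x z × ⟦ s ⟧ S z y
⟦ t ⊕ s ⟧ S x y = ⟦ t ⟧ S x y ⊎ ⟦ s ⟧ S x y
⟦ t ⊓ s ⟧ S x y = ⟦ t ⟧ S x y × ⟦ s ⟧ S x y
⟦ t ˘ ⟧ S x y = ⟦ t ⟧ S y x
⟦ t ⋆ ⟧ S x y = Star (⟦ t ⟧ S) x y

REL⊨_≤_ : ∀ {Σ} → Term Σ → Term Σ → Set₁
REL⊨_≤_ {Σ} t s = (A : Set) (S : Structure Σ A) (x y : A) → ⟦ t ⟧ S x y → ⟦ s ⟧ S x y

maxF : ∀ {l} → (Fin l → ℕ) → ℕ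
maxF {zero} f = 0
maxF {suc l} f = f F.zero ⊔ maxF (λ i → f (F.suc i))

record PathDecomposition {Σ : Set} {n : ℕ} (S : Structure Σ (Fin n)) : Set where
  field
    len     : ℕ
    bag     : Fin len → Subset n
    covers  : ∀ x → ∃ λ i → x ∈ bag i
    edges   : ∀ a x y → rel S a x y → ∃ λ i → x ∈ bag i × y ∈ bag i
    interp  : ∀ (i j k : Fin len) → i F.≤ j → j F.≤ k →
              ∀ x → x ∈ bag i → x ∈ bag k → x ∈ bag j

open PathDecomposition public

width : ∀ {Σ n} {S : Structure Σ (Fin n)} → PathDecomposition S → ℕ
width D = maxF (λ i → ∣ bag D i ∣ ∸ 1)

-- pw(S) ≤ k  (pw is the minimum width, so this is: some decomposition has width ≤ k)
pw≤ : ∀ {Σ n} → Structure Σ (Fin n) → ℕ → Set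
pw≤ S k = Σ (PathDecomposition S) λ D → width D ≤ k

RELpw≤_⊨_≤_ : ∀ {Σ} → ℕ → Term Σ → Term Σ → Set₁
RELpw≤_⊨_≤_ {Σ} k t s = (n : ℕ) (S : Structure Σ (Fin n)) → pw≤ S k →
  (x y : Fin n) → ⟦ t ⟧ S x y → ⟦ s ⟧ S x y

{-# OPTIONS --safe #-}
module Submission where

-- Validity in REL trivially implies validity on the finite structures of bounded pathwidth.
-- Conversely, whenever x ⟦t⟧ y in a structure S, there is a finite structure G with a homomorphism
-- to S, vertices x′ ↦ x and y′ ↦ y with x′ ⟦t⟧ y′ in G, and a path decomposition of G of width
-- ≤ iw t whose first bag contains x′ and whose last bag contains y′. G is built by induction on t:
-- for t ⨾ u and t ⋆ the decompositions are concatenated, the target of the first being glued to the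
-- source of the second; for t ˘ the bags are reversed; for t ⊓ u the source of one decomposition is
-- added to all of its bags and the target of the other to all of its bags, after which both
-- endpoints can be glued at once, which costs one vertex per bag on either side and gives width
-- iw t + iw u. If REL_{pw ≤ iw t} ⊨ t ≤ s, then x′ ⟦s⟧ y′ in G, and s, like every PCoR* term, is
-- preserved by the homomorphism.

open import Defs
open import Data.Empty using (⊥-elim)
open import Data.Fin using (Fin; zero; suc; toℕ; fromℕ<; _↑ˡ_; _↑ʳ_; _≟_)
open import Data.Fin.Properties using (toℕ-fromℕ<; toℕ<n; toℕ-injective; any?; suc-injective; 0≢1+n)
open import Data.Fin.Subset using (Subset; inside; outside; ⁅_⁆; _∪_; _∩_; ∣_∣; _∈_)
  renaming (⊥ to ∅; ⊤ to full)
open import Data.Fin.Subset.Properties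
  using ( x∈p∪q⁺; x∈p∪q⁻; x∈p∩q⁺; x∈p∩q⁻; x∈⁅x⁆; x∈⁅y⁆⇒x≡y; ∉⊥; ∈⊤; _∈?_
        ; ∣⊥∣≡0; ∣⊤∣≡n; ∣⁅x⁆∣≡1; ∪-identityˡ; Empty-unique)
open import Data.List using (List; []; _∷_)
open import Data.List.Relation.Unary.All using (All; []; _∷_)
open import Data.Maybe using (Maybe; just; nothing; maybe′)
open import Data.Maybe.Properties using (just-injective; ≡-dec)
open import Data.Nat using (ℕ; zero; suc; _+_; _∸_; _⊔_; _≤_; _<_; z≤n; s≤s; _≤?_)
  renaming (_≟_ to _≟ℕ_)
open import Data.Nat.Properties
  using ( ≤-refl; ≤-reflexive; ≤-trans; ≤-antisym; ≰⇒>; 1+n≰n; n≤1+n; m≤m+n; m+n≤o⇒m≤o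
        ; +-comm; +-suc; +-identityʳ; +-monoˡ-≤; +-monoʳ-≤; +-monoʳ-<; +-cancelˡ-≤
        ; m≤m⊔n; m≤n⊔m; ⊔-lub; ⊔-comm; ⊔-idem
        ; m+n∸m≡n; m+[n∸m]≡n; n∸n≡0; m∸n≤m; m∸[m∸n]≡n; ∸-monoˡ-≤; ∸-monoʳ-≤
        ; module ≤-Reasoning)
open import Data.Product using (∃-syntax; _×_; _,_; proj₁; proj₂; swap)
open import Data.Sum using (inj₁; inj₂)
open import Data.Unit using (tt)
open import Data.Vec using (Vec; []; _∷_; _++_; lookup; tabulate; here; there)
open import Data.Vec.Properties using (lookup∘tabulate; lookup-++ˡ; lookup-++ʳ; []=⇒lookup; lookup⇒[]=)
open import Function using (_∘_; const; id)
open import Function.Bundles using (_⇔_; mk⇔)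
open import Relation.Binary.Construct.Closure.ReflexiveTransitive using (Star; ε; _◅_; gmap)
open import Relation.Binary.PropositionalEquality
open import Relation.Nullary using (¬_; Dec; yes; no; does; contradiction)
open import Relation.Nullary.Decidable using (dec-true; map′; ¬?; _×-dec_)
open import Relation.Unary using (Decidable)

private
  variable
    n n₁ n₂ : ℕ

Homomorphism : ∀ {Σ A B} → Structure Σ A → Structure Σ B → (A → B) → Set
Homomorphism S T f = ∀ a {u v} → rel S a u v → rel T a (f u) (f v)

homomorphism-preserves : ∀ {Σ A B} {S : Structure Σ A} {T : Structure Σ B} {f : A → B} →
                         Homomorphism S T f → ∀ t {u v} → ⟦ t ⟧ S u v → ⟦ t ⟧ T (f u) (f v)
homomorphism-preserves hom (var a) p = hom a p
homomorphism-preserves hom one refl = refl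
homomorphism-preserves hom top _ = tt
homomorphism-preserves {f = f} hom (t ⨾ s) (z , p , q) =
  f z , homomorphism-preserves hom t p , homomorphism-preserves hom s q
homomorphism-preserves hom (t ⊕ s) (inj₁ p) = inj₁ (homomorphism-preserves hom t p)
homomorphism-preserves hom (t ⊕ s) (inj₂ q) = inj₂ (homomorphism-preserves hom s q)
homomorphism-preserves hom (t ⊓ s) (p , q) =
  homomorphism-preserves hom t p , homomorphism-preserves hom s q
homomorphism-preserves hom (t ˘) p = homomorphism-preserves hom t p
homomorphism-preserves {f = f} hom (t ⋆) p = gmap f (homomorphism-preserves hom t) p

1≤iw : ∀ {Σ} (t : Term Σ) → 1 ≤ iw t
1≤iw (var a) = ≤-refl
1≤iw one = ≤-refl
1≤iw zer = ≤-refl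
1≤iw top = ≤-refl
1≤iw (t ⨾ s) = ≤-trans (1≤iw t) (m≤m⊔n (iw t) (iw s))
1≤iw (t ⊕ s) = ≤-trans (1≤iw t) (m≤m⊔n (iw t) (iw s))
1≤iw (t ⊓ s) = ≤-trans (1≤iw t) (m≤m+n (iw t) (iw s))
1≤iw (t ˘) = 1≤iw t
1≤iw (t ⋆) = 1≤iw t

suc⊔suc≤+ : ∀ {m n} → 1 ≤ m → 1 ≤ n → suc m ⊔ suc n ≤ m + n
suc⊔suc≤+ {m} {n} 1≤m 1≤n = ⊔-lub (subst (_≤ m + n) (+-comm m 1) (+-monoʳ-≤ m 1≤n)) (+-monoˡ-≤ n 1≤m)

-- Subsets of Fin n

∣p∪q∣≤∣p∣+∣q∣ : ∀ {n} (p q : Subset n) → ∣ p ∪ q ∣ ≤ ∣ p ∣ + ∣ q ∣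
∣p∪q∣≤∣p∣+∣q∣ [] [] = z≤n
∣p∪q∣≤∣p∣+∣q∣ (outside ∷ p) (outside ∷ q) = ∣p∪q∣≤∣p∣+∣q∣ p q
∣p∪q∣≤∣p∣+∣q∣ (outside ∷ p) (inside ∷ q) =
  ≤-trans (s≤s (∣p∪q∣≤∣p∣+∣q∣ p q)) (≤-reflexive (sym (+-suc ∣ p ∣ ∣ q ∣)))
∣p∪q∣≤∣p∣+∣q∣ (inside ∷ p) (outside ∷ q) = s≤s (∣p∪q∣≤∣p∣+∣q∣ p q)
∣p∪q∣≤∣p∣+∣q∣ (inside ∷ p) (inside ∷ q) =
  s≤s (≤-trans (∣p∪q∣≤∣p∣+∣q∣ p q) (+-monoʳ-≤ ∣ p ∣ (n≤1+n ∣ q ∣)))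

∣p++q∣≡∣p∣+∣q∣ : ∀ {n₁ n₂} (p : Subset n₁) (q : Subset n₂) → ∣ p ++ q ∣ ≡ ∣ p ∣ + ∣ q ∣
∣p++q∣≡∣p∣+∣q∣ [] q = refl
∣p++q∣≡∣p∣+∣q∣ (outside ∷ p) q = ∣p++q∣≡∣p∣+∣q∣ p q
∣p++q∣≡∣p∣+∣q∣ (inside ∷ p) q = cong suc (∣p++q∣≡∣p∣+∣q∣ p q)

∣p∣≤1 : ∀ {n} (p : Subset n) → (∀ {u v} → u ∈ p → v ∈ p → u ≡ v) → ∣ p ∣ ≤ 1
∣p∣≤1 [] _ = z≤n
∣p∣≤1 (outside ∷ p) unique = ∣p∣≤1 p (λ u∈p v∈p → suc-injective (unique (there u∈p) (there v∈p)))
∣p∣≤1 {suc n} (inside ∷ p) unique = s≤s (≤-reflexive (begin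
  ∣ p ∣         ≡⟨ cong ∣_∣ (Empty-unique (λ (v , v∈p) → 0≢1+n (unique here (there v∈p)))) ⟩
  ∣ ∅ {n = n} ∣ ≡⟨ ∣⊥∣≡0 n ⟩
  0             ∎))
  where open ≡-Reasoning

∈-++ˡ⁺ : ∀ {v : Fin n₁} {p : Subset n₁} (q : Subset n₂) → v ∈ p → v ↑ˡ n₂ ∈ p ++ q
∈-++ˡ⁺ q here = here
∈-++ˡ⁺ q (there v∈p) = there (∈-++ˡ⁺ q v∈p)

∈-++ʳ⁺ : ∀ {v : Fin n₂} (p : Subset n₁) {q : Subset n₂} → v ∈ q → n₁ ↑ʳ v ∈ p ++ q
∈-++ʳ⁺ [] v∈q = v∈q
∈-++ʳ⁺ (_ ∷ p) v∈q = there (∈-++ʳ⁺ p v∈q)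

∈-++ˡ⁻ : ∀ {v : Fin n₁} (p : Subset n₁) {q : Subset n₂} → v ↑ˡ n₂ ∈ p ++ q → v ∈ p
∈-++ˡ⁻ {v = zero} (_ ∷ p) here = here
∈-++ˡ⁻ {v = suc v} (_ ∷ p) (there v∈) = there (∈-++ˡ⁻ p v∈)

∈-++ʳ⁻ : ∀ {v : Fin n₂} (p : Subset n₁) {q : Subset n₂} → n₁ ↑ʳ v ∈ p ++ q → v ∈ q
∈-++ʳ⁻ [] v∈ = v∈
∈-++ʳ⁻ (_ ∷ p) (there v∈) = ∈-++ʳ⁻ p v∈

data Side (n₁ n₂ : ℕ) : Fin (n₁ + n₂) → Set where
  left  : (v : Fin n₁) → Side n₁ n₂ (v ↑ˡ n₂)
  right : (v : Fin n₂) → Side n₁ n₂ (n₁ ↑ʳ v)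

side : ∀ n₁ {n₂} (w : Fin (n₁ + n₂)) → Side n₁ n₂ w
side zero w = right w
side (suc n₁) zero = left zero
side (suc n₁) (suc w) with side n₁ w
... | left v = left (suc v)
... | right v = right v

select : ∀ {n} {P : Fin n → Set} → Decidable P → Subset n
select P? = tabulate (does ∘ P?)

module _ {n} {P : Fin n → Set} (P? : Decidable P) where

  ∈-select⁺ : ∀ {v} → P v → v ∈ select P?
  ∈-select⁺ {v} pv = lookup⇒[]= v _ (trans (lookup∘tabulate (does ∘ P?) v) (dec-true (P? v) pv))

  ∈-select⁻ : ∀ {v} → v ∈ select P? → P v
  ∈-select⁻ {v} v∈ with P? v | trans (sym (lookup∘tabulate (does ∘ P?) v)) ([]=⇒lookup v∈)
  ... | yes pv | _ = pv
  ... | no _ | ()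

image : (Fin n₂ → Maybe (Fin n₁)) → Subset n₂ → Subset n₁
image φ [] = ∅
image φ (outside ∷ p) = image (φ ∘ suc) p
image φ (inside ∷ p) = maybe′ ⁅_⁆ ∅ (φ zero) ∪ image (φ ∘ suc) p

unmatched? : (φ : Fin n₂ → Maybe (Fin n₁)) → Decidable (λ b → φ b ≡ nothing)
unmatched? φ b = ≡-dec _≟_ (φ b) nothing

unmatched : (Fin n₂ → Maybe (Fin n₁)) → Subset n₂ → Subset n₂
unmatched φ p = p ∩ select (unmatched? φ)

∈-image⁺ : ∀ (φ : Fin n₂ → Maybe (Fin n₁)) {p b a} → b ∈ p → φ b ≡ just a → a ∈ image φ p
∈-image⁺ φ {inside ∷ p} here φb≡a rewrite φb≡a = x∈p∪q⁺ (inj₁ (x∈⁅x⁆ _))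
∈-image⁺ φ {outside ∷ p} (there b∈p) φb≡a = ∈-image⁺ (φ ∘ suc) b∈p φb≡a
∈-image⁺ φ {inside ∷ p} (there b∈p) φb≡a = x∈p∪q⁺ (inj₂ (∈-image⁺ (φ ∘ suc) b∈p φb≡a))

∈-image⁻ : ∀ (φ : Fin n₂ → Maybe (Fin n₁)) p {a} → a ∈ image φ p → ∃[ b ] b ∈ p × φ b ≡ just a
∈-image⁻ φ [] a∈ = ⊥-elim (∉⊥ a∈)
∈-image⁻ φ (outside ∷ p) a∈ with ∈-image⁻ (φ ∘ suc) p a∈
... | b , b∈p , φb≡a = suc b , there b∈p , φb≡a
∈-image⁻ φ (inside ∷ p) a∈ with x∈p∪q⁻ (maybe′ ⁅_⁆ ∅ (φ zero)) _ a∈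
... | inj₁ a∈φ0 = zero , here , ∈-maybe (φ zero) a∈φ0
  where
  ∈-maybe : ∀ x {a} → a ∈ maybe′ ⁅_⁆ ∅ x → x ≡ just a
  ∈-maybe (just a′) a∈ = cong just (sym (x∈⁅y⁆⇒x≡y a′ a∈))
  ∈-maybe nothing a∈ = ⊥-elim (∉⊥ a∈)
... | inj₂ a∈′ with ∈-image⁻ (φ ∘ suc) p a∈′
...   | b , b∈p , φb≡a = suc b , there b∈p , φb≡a

∈-unmatched⁺ : ∀ (φ : Fin n₂ → Maybe (Fin n₁)) {p b} → b ∈ p → φ b ≡ nothing → b ∈ unmatched φ p
∈-unmatched⁺ φ b∈p φb≡nothing = x∈p∩q⁺ (b∈p , ∈-select⁺ (unmatched? φ) φb≡nothing)

∈-unmatched⁻ : ∀ (φ : Fin n₂ → Maybe (Fin n₁)) p {b} → b ∈ unmatched φ p → b ∈ p × φ b ≡ nothing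
∈-unmatched⁻ φ p b∈ with x∈p∩q⁻ p _ b∈
... | b∈p , b∈sel = b∈p , ∈-select⁻ (unmatched? φ) b∈sel

∣image∣+∣unmatched∣≤∣p∣ : ∀ (φ : Fin n₂ → Maybe (Fin n₁)) p →
                          ∣ image φ p ∣ + ∣ unmatched φ p ∣ ≤ ∣ p ∣
∣image∣+∣unmatched∣≤∣p∣ {n₁ = n₁} φ [] = ≤-reflexive (cong (_+ 0) (∣⊥∣≡0 n₁))
∣image∣+∣unmatched∣≤∣p∣ φ (outside ∷ p) = ∣image∣+∣unmatched∣≤∣p∣ (φ ∘ suc) p
∣image∣+∣unmatched∣≤∣p∣ {n₂ = suc n₂} {n₁} φ (inside ∷ p) with φ zero | ∣image∣+∣unmatched∣≤∣p∣ (φ ∘ suc) p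
... | nothing | ih = begin
  ∣ ∅ ∪ I ∣ + suc ∣ U ∣ ≡⟨ cong (λ q → ∣ q ∣ + suc ∣ U ∣) (∪-identityˡ I) ⟩
  ∣ I ∣ + suc ∣ U ∣     ≡⟨ +-suc ∣ I ∣ ∣ U ∣ ⟩
  suc (∣ I ∣ + ∣ U ∣)   ≤⟨ s≤s ih ⟩
  suc ∣ p ∣             ∎
  where
  open ≤-Reasoning
  I : Subset n₁
  I = image (φ ∘ suc) p
  U : Subset n₂
  U = unmatched (φ ∘ suc) p
... | just a | ih = begin
  ∣ ⁅ a ⁆ ∪ I ∣ + ∣ U ∣        ≤⟨ +-monoˡ-≤ ∣ U ∣ (∣p∪q∣≤∣p∣+∣q∣ ⁅ a ⁆ I) ⟩
  (∣ ⁅ a ⁆ ∣ + ∣ I ∣) + ∣ U ∣  ≡⟨ cong (λ c → c + ∣ I ∣ + ∣ U ∣) (∣⁅x⁆∣≡1 a) ⟩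
  suc (∣ I ∣ + ∣ U ∣)          ≤⟨ s≤s ih ⟩
  suc ∣ p ∣                    ∎
  where
  open ≤-Reasoning
  I : Subset n₁
  I = image (φ ∘ suc) p
  U : Subset n₂
  U = unmatched (φ ∘ suc) p

-- Sequences of bags

data Phase (m : ℕ) : ℕ → Set where
  early : ∀ {i} → i ≤ m → Phase m i
  late  : ∀ j → Phase m (suc m + j)

phase : ∀ m i → Phase m i
phase m i with i ≤? m
... | yes i≤m = early i≤m
... | no i≰m = subst (Phase m) (m+[n∸m]≡n (≰⇒> i≰m)) (late (i ∸ suc m))

1+m+n≰m : ∀ {m n} → ¬ suc m + n ≤ m
1+m+n≰m {m} le = 1+n≰n (m+n≤o⇒m≤o (suc m) le)

-- Opaque so that m, f and g can be inferred from `splice m f g i`.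
opaque
  splice : ℕ → (ℕ → Subset n) → (ℕ → Subset n) → ℕ → Subset n
  splice m f g i with i ≤? m
  ... | yes _ = f i
  ... | no _ = g (i ∸ suc m)

opaque
  unfolding splice

  splice-early : ∀ {m i} {f g : ℕ → Subset n} → i ≤ m → splice m f g i ≡ f i
  splice-early {m = m} {i} i≤m with i ≤? m
  ... | yes _ = refl
  ... | no i≰m = contradiction i≤m i≰m

  splice-late : ∀ {m} j {f g : ℕ → Subset n} → splice m f g (suc m + j) ≡ g j
  splice-late {m = m} j {g = g} with suc m + j ≤? m
  ... | yes le = contradiction le 1+m+n≰m
  ... | no _ = cong g (m+n∸m≡n (suc m) j)

module _ {m : ℕ} {f g : ℕ → Subset n} {v : Fin n} where

  splice-early⁺ : ∀ {i} → i ≤ m → v ∈ f i → v ∈ splice m f g i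
  splice-early⁺ i≤m = subst (v ∈_) (sym (splice-early i≤m))

  splice-early⁻ : ∀ {i} → i ≤ m → v ∈ splice m f g i → v ∈ f i
  splice-early⁻ i≤m = subst (v ∈_) (splice-early i≤m)

  splice-late⁺ : ∀ {j} → v ∈ g j → v ∈ splice m f g (suc m + j)
  splice-late⁺ {j} = subst (v ∈_) (sym (splice-late j))

  splice-late⁻ : ∀ {j} → v ∈ splice m f g (suc m + j) → v ∈ g j
  splice-late⁻ {j} = subst (v ∈_) (splice-late j)

splice-thin : ∀ {m c} {f g : ℕ → Subset n} → (∀ {i} → i ≤ m → ∣ f i ∣ ≤ c) → (∀ j → ∣ g j ∣ ≤ c) →
              ∀ i → ∣ splice m f g i ∣ ≤ c
splice-thin {m = m} thin-f thin-g i with phase m i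
... | early i≤m = subst (λ p → ∣ p ∣ ≤ _) (sym (splice-early i≤m)) (thin-f i≤m)
... | late j = subst (λ p → ∣ p ∣ ≤ _) (sym (splice-late j)) (thin-g j)

Convex : (ℕ → Subset n) → Set
Convex B = ∀ {i j k v} → i ≤ j → j ≤ k → v ∈ B i → v ∈ B k → v ∈ B j

convex-splice : ∀ {m} {f g : ℕ → Subset n} → Convex f → Convex g →
                (∀ {i k v} → i ≤ m → v ∈ f i → v ∈ g k → v ∈ f m × v ∈ g 0) →
                Convex (splice m f g)
convex-splice {m = m} {f} {g} convex-f convex-g bridge {i} {j} {k} i≤j j≤k v∈i v∈k with phase m j
... | early j≤m = splice-early⁺ j≤m (from-f (phase m k) (splice-early⁻ i≤m v∈i) v∈k j≤k)
  where
  i≤m : i ≤ m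
  i≤m = ≤-trans i≤j j≤m
  from-f : ∀ {k v} → Phase m k → v ∈ f i → v ∈ splice m f g k → j ≤ k → v ∈ f j
  from-f (early k≤m) v∈fi v∈k j≤k = convex-f i≤j j≤k v∈fi (splice-early⁻ k≤m v∈k)
  from-f (late k′) v∈fi v∈k _ = convex-f i≤j j≤m v∈fi (proj₁ (bridge i≤m v∈fi (splice-late⁻ v∈k)))
... | late j′ = splice-late⁺ (from-g (phase m i) (phase m k) v∈i v∈k i≤j j≤k)
  where
  from-g : ∀ {i k v} → Phase m i → Phase m k → v ∈ splice m f g i → v ∈ splice m f g k →
           i ≤ suc m + j′ → suc m + j′ ≤ k → v ∈ g j′
  from-g _ (early k≤m) _ _ _ j≤k = contradiction (≤-trans j≤k k≤m) 1+m+n≰m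
  from-g (early i≤m) (late k′) v∈i v∈k _ j≤k =
    convex-g z≤n (+-cancelˡ-≤ (suc m) _ _ j≤k)
      (proj₂ (bridge i≤m (splice-early⁻ i≤m v∈i) (splice-late⁻ v∈k))) (splice-late⁻ v∈k)
  from-g (late i′) (late k′) v∈i v∈k i≤j j≤k =
    convex-g (+-cancelˡ-≤ (suc m) _ _ i≤j) (+-cancelˡ-≤ (suc m) _ _ j≤k)
      (splice-late⁻ v∈i) (splice-late⁻ v∈k)

convex-∅ : Convex {n} (const ∅)
convex-∅ _ _ v∈∅ _ = contradiction v∈∅ ∉⊥

convex-∪-const : ∀ {f : ℕ → Subset n} (q : Subset n) → Convex f → Convex (λ i → f i ∪ q)
convex-∪-const {f = f} q convex-f i≤j j≤k v∈i v∈k with x∈p∪q⁻ (f _) q v∈i | x∈p∪q⁻ (f _) q v∈k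
... | inj₁ v∈fi | inj₁ v∈fk = x∈p∪q⁺ (inj₁ (convex-f i≤j j≤k v∈fi v∈fk))
... | inj₂ v∈q | _ = x∈p∪q⁺ (inj₂ v∈q)
... | _ | inj₂ v∈q = x∈p∪q⁺ (inj₂ v∈q)

convex-reverse : ∀ {f : ℕ → Subset n} m → Convex f → Convex (λ i → f (m ∸ i))
convex-reverse m convex-f i≤j j≤k v∈i v∈k = convex-f (∸-monoʳ-≤ m j≤k) (∸-monoʳ-≤ m i≤j) v∈k v∈i

convex-++ : ∀ {f : ℕ → Subset n₁} {g : ℕ → Subset n₂} → Convex f → Convex g →
            Convex (λ i → f i ++ g i)
convex-++ {n₁ = n₁} {f = f} {g} convex-f convex-g {i} {j} {k} {w} i≤j j≤k w∈i w∈k with side n₁ w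
... | left v = ∈-++ˡ⁺ (g j) (convex-f i≤j j≤k (∈-++ˡ⁻ (f i) w∈i) (∈-++ˡ⁻ (f k) w∈k))
... | right v = ∈-++ʳ⁺ (f j) (convex-g i≤j j≤k (∈-++ʳ⁻ (f i) w∈i) (∈-++ʳ⁻ (f k) w∈k))

Bounded : ℕ → (ℕ → Subset n) → Set
Bounded m B = ∀ {i v} → v ∈ B i → i ≤ m

splice-bounded : ∀ {m m′} {f g : ℕ → Subset n} → Bounded m′ g → Bounded (suc m + m′) (splice m f g)
splice-bounded {m = m} {m′} g-bounded {i} v∈ with phase m i
... | early i≤m = ≤-trans i≤m (≤-trans (n≤1+n m) (m≤m+n (suc m) m′))
... | late j = +-monoʳ-≤ (suc m) (g-bounded (splice-late⁻ v∈))

bounded-++ : ∀ {m} {f : ℕ → Subset n₁} {g : ℕ → Subset n₂} → Bounded m f → Bounded m g →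
             Bounded m (λ i → f i ++ g i)
bounded-++ {n₁ = n₁} {f = f} f-bounded g-bounded {v = w} w∈ with side n₁ w
... | left v = f-bounded (∈-++ˡ⁻ (f _) w∈)
... | right v = g-bounded (∈-++ʳ⁻ (f _) w∈)

truncate : ℕ → (ℕ → Subset n) → ℕ → Subset n
truncate m f = splice m f (const ∅)

module _ {n m : ℕ} {f : ℕ → Subset n} where

  truncate-bounded : Bounded m (truncate m f)
  truncate-bounded {i} v∈ with phase m i
  ... | early i≤m = i≤m
  ... | late j = contradiction (splice-late⁻ v∈) ∉⊥

  convex-truncate : Convex f → Convex (truncate m f)
  convex-truncate convex-f = convex-splice convex-f convex-∅ (λ _ _ v∈∅ → contradiction v∈∅ ∉⊥)

  truncate-thin : ∀ {c} → (∀ {i} → i ≤ m → ∣ f i ∣ ≤ c) → ∀ i → ∣ truncate m f i ∣ ≤ c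
  truncate-thin thin-f = splice-thin thin-f (λ _ → ≤-trans (≤-reflexive (∣⊥∣≡0 n)) z≤n)

-- Opaque for the same reason as `splice`.
opaque
  assoc : List (Fin n₂ × Fin n₁) → Fin n₂ → Maybe (Fin n₁)
  assoc [] b = nothing
  assoc ((b′ , a) ∷ ps) b with b ≟ b′
  ... | yes _ = just a
  ... | no _ = assoc ps b

  assoc-head : ∀ {b : Fin n₂} {a : Fin n₁} ps → assoc ((b , a) ∷ ps) b ≡ just a
  assoc-head {b = b} ps with b ≟ b
  ... | yes _ = refl
  ... | no b≢b = contradiction refl b≢b

  assoc-tail : ∀ {b b′ : Fin n₂} {a : Fin n₁} ps → b ≢ b′ → assoc ((b′ , a) ∷ ps) b ≡ assoc ps b
  assoc-tail {b = b} {b′} ps b≢b′ with b ≟ b′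
  ... | yes b≡b′ = contradiction b≡b′ b≢b′
  ... | no _ = refl

  assoc-All : ∀ {P : Fin n₂ × Fin n₁ → Set} {ps} → All P ps →
              ∀ {b a} → assoc ps b ≡ just a → P (b , a)
  assoc-All {P = P} {(b′ , a′) ∷ ps} (p ∷ ps-ok) {b} eq with b ≟ b′
  ... | yes refl = subst (λ a → P (b , a)) (just-injective eq) p
  ... | no _ = assoc-All ps-ok eq

maxF-≤ : ∀ {l c} (f : Fin l → ℕ) → (∀ i → f i ≤ c) → maxF f ≤ c
maxF-≤ {zero} f f≤c = z≤n
maxF-≤ {suc l} f f≤c = ⊔-lub (f≤c zero) (maxF-≤ (f ∘ suc) (f≤c ∘ suc))

pw≤-fromBags : ∀ {Σ n k} {T : Structure Σ (Fin n)} (len : ℕ) (B : ℕ → Subset n) →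
               Convex B → (∀ i → ∣ B i ∣ ≤ suc k) →
               (∀ v → ∃[ i ] i < len × v ∈ B i) →
               (∀ a u v → rel T a u v → ∃[ i ] i < len × u ∈ B i × v ∈ B i) →
               pw≤ T k
pw≤-fromBags {k = k} {T} len B convex thin covered joined = decomposition , width≤k
  where
  at : ∀ {i v} (i<len : i < len) → v ∈ B i → v ∈ B (toℕ (fromℕ< i<len))
  at {v = v} i<len = subst (λ i → v ∈ B i) (sym (toℕ-fromℕ< i<len))

  decomposition : PathDecomposition T
  decomposition = record
    { len = len
    ; bag = B ∘ toℕ
    ; covers = λ v → let (i , i<len , v∈) = covered v in fromℕ< i<len , at i<len v∈
    ; edges = λ a u v uv → let (i , i<len , u∈ , v∈) = joined a u v uv in
                           fromℕ< i<len , at i<len u∈ , at i<len v∈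
    ; interp = λ _ _ _ i≤j j≤k _ x∈i x∈k → convex i≤j j≤k x∈i x∈k
    }

  width≤k : width decomposition ≤ k
  width≤k = maxF-≤ {len} _ (λ p → ∸-monoˡ-≤ 1 (thin (toℕ p)))

-- Decomposed finite structures over a structure S

module Realisation {Σ A : Set} (S : Structure Σ A) where

  -- A vertex may lie in no bag: gluing produces such vertices, and `pw≤-graph` gives each of them
  -- a bag of its own.
  record Decomposed (k : ℕ) : Set where
    field
      order     : ℕ
      label     : Vec A order
      last      : ℕ
      bags      : ℕ → Subset order
      convex    : Convex bags
      bounded   : Bounded last bags
      thin      : ∀ i → ∣ bags i ∣ ≤ suc k
      src tgt   : Fin order
      src∈first : src ∈ bags 0
      tgt∈last  : tgt ∈ bags last

    Adjacent : Fin order → Fin order → Set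
    Adjacent u v = ∃[ i ] u ∈ bags i × v ∈ bags i

    graph : Structure Σ (Fin order)
    graph = record
      { point = src
      ; rel = λ a u v → rel S a (lookup label u) (lookup label v) × Adjacent u v
      }

    label-homomorphism : Homomorphism graph S (lookup label)
    label-homomorphism a = proj₁

  open Decomposed

  record Embedding {k₁ k₂} (d₁ : Decomposed k₁) (d₂ : Decomposed k₂) : Set where
    field
      vertex       : Fin (order d₁) → Fin (order d₂)
      time         : ℕ → ℕ
      label-vertex : ∀ v → lookup (label d₂) (vertex v) ≡ lookup (label d₁) v
      bags-vertex  : ∀ {i v} → v ∈ bags d₁ i → vertex v ∈ bags d₂ (time i)

    homomorphism : Homomorphism (graph d₁) (graph d₂) vertex
    homomorphism a {u} {v} (uv , i , u∈ , v∈) =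
      subst₂ (rel S a) (sym (label-vertex u)) (sym (label-vertex v)) uv ,
      time i , bags-vertex u∈ , bags-vertex v∈

    transport : ∀ t {u v} → ⟦ t ⟧ (graph d₁) u v → ⟦ t ⟧ (graph d₂) (vertex u) (vertex v)
    transport = homomorphism-preserves homomorphism

  open Embedding

  flat : ∀ {n k} → Vec A n → n ≤ suc k → (src tgt : Fin n) → Decomposed k
  flat {n} xs n≤1+k s t = record
    { order = n ; label = xs ; last = 0
    ; bags = truncate 0 (const full)
    ; convex = convex-truncate (λ _ _ _ _ → ∈⊤)
    ; bounded = truncate-bounded
    ; thin = truncate-thin (λ _ → ≤-trans (≤-reflexive (∣⊤∣≡n n)) n≤1+k)
    ; src = s ; tgt = t
    ; src∈first = splice-early⁺ z≤n ∈⊤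
    ; tgt∈last = splice-early⁺ z≤n ∈⊤
    }

  widen : ∀ {k} (d : Decomposed k) → Fin (order d) → Decomposed (suc k)
  widen d a = record
    { order = order d ; label = label d ; last = last d
    ; bags = truncate (last d) (λ i → bags d i ∪ ⁅ a ⁆)
    ; convex = convex-truncate (convex-∪-const ⁅ a ⁆ (convex d))
    ; bounded = truncate-bounded
    ; thin = truncate-thin (λ {i} _ → begin
        ∣ bags d i ∪ ⁅ a ⁆ ∣     ≤⟨ ∣p∪q∣≤∣p∣+∣q∣ (bags d i) ⁅ a ⁆ ⟩
        ∣ bags d i ∣ + ∣ ⁅ a ⁆ ∣ ≡⟨ cong (∣ bags d i ∣ +_) (∣⁅x⁆∣≡1 a) ⟩
        ∣ bags d i ∣ + 1         ≤⟨ +-monoˡ-≤ 1 (thin d i) ⟩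
        suc _ + 1                ≡⟨ +-comm _ 1 ⟩
        suc (suc _)              ∎)
    ; src = src d ; tgt = tgt d
    ; src∈first = splice-early⁺ z≤n (x∈p∪q⁺ (inj₁ (src∈first d)))
    ; tgt∈last = splice-early⁺ ≤-refl (x∈p∪q⁺ (inj₁ (tgt∈last d)))
    }
    where open ≤-Reasoning

  ∈-widen : ∀ {k} (d : Decomposed k) (a : Fin (order d)) {i} → i ≤ last d → a ∈ bags (widen d a) i
  ∈-widen d a i≤last = splice-early⁺ i≤last (x∈p∪q⁺ (inj₂ (x∈⁅x⁆ a)))

  widen-embedding : ∀ {k} (d : Decomposed k) (a : Fin (order d)) → Embedding d (widen d a)
  widen-embedding d a = record
    { vertex = id ; time = id ; label-vertex = λ _ → refl
    ; bags-vertex = λ v∈ → splice-early⁺ (bounded d v∈) (x∈p∪q⁺ (inj₁ v∈))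
    }

  reverse : ∀ {k} → Decomposed k → Decomposed k
  reverse d = record
    { order = order d ; label = label d ; last = last d
    ; bags = truncate (last d) (λ i → bags d (last d ∸ i))
    ; convex = convex-truncate (convex-reverse (last d) (convex d))
    ; bounded = truncate-bounded
    ; thin = truncate-thin (λ {i} _ → thin d (last d ∸ i))
    ; src = tgt d ; tgt = src d
    ; src∈first = splice-early⁺ z≤n (tgt∈last d)
    ; tgt∈last = splice-early⁺ ≤-refl
        (subst (λ i → src d ∈ bags d i) (sym (n∸n≡0 (last d))) (src∈first d))
    }

  reverse-embedding : ∀ {k} (d : Decomposed k) → Embedding d (reverse d)
  reverse-embedding d = record
    { vertex = id ; time = last d ∸_ ; label-vertex = λ _ → refl
    ; bags-vertex = λ {i} {v} v∈ → splice-early⁺ (m∸n≤m (last d) i)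
        (subst (λ j → v ∈ bags d j) (sym (m∸[m∸n]≡n (bounded d v∈))) v∈)
    }

  Matches : ∀ {k₁ k₂} (d₁ : Decomposed k₁) (d₂ : Decomposed k₂) →
            Fin (order d₂) × Fin (order d₁) → Set
  Matches d₁ d₂ (b , a) =
    b ∈ bags d₂ 0 × a ∈ bags d₁ (last d₁) × lookup (label d₁) a ≡ lookup (label d₂) b

  -- The bags of d₂ follow those of d₁, and each vertex b of d₂ with (b , a) ∈ ports is replaced
  -- by a, which therefore stays in the later bags as long as some such b would. The width does not
  -- grow, since each such a is counted once for at least one b (∣image∣+∣unmatched∣≤∣p∣).
  module Glue {k₁ k₂} (d₁ : Decomposed k₁) (d₂ : Decomposed k₂)
              (ports : List (Fin (order d₂) × Fin (order d₁)))
              (matching : All (Matches d₁ d₂) ports) where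

    private
      m₁ : ℕ
      m₁ = last d₁

      φ : Fin (order d₂) → Maybe (Fin (order d₁))
      φ = assoc ports

      matches : ∀ {b a} → φ b ≡ just a → Matches d₁ d₂ (b , a)
      matches = assoc-All matching

      image-bags : ℕ → Subset (order d₁)
      image-bags j = image φ (bags d₂ j)

      unmatched-bags : ℕ → Subset (order d₂)
      unmatched-bags j = unmatched φ (bags d₂ j)

      image-down : ∀ {j k a} → j ≤ k → a ∈ image-bags k → a ∈ image-bags j
      image-down {k = k} j≤k a∈ with ∈-image⁻ φ (bags d₂ k) a∈
      ... | b , b∈ , φb≡a = ∈-image⁺ φ (convex d₂ z≤n j≤k (proj₁ (matches φb≡a)) b∈) φb≡a

      convex-unmatched : Convex unmatched-bags
      convex-unmatched {i} {j} {k} i≤j j≤k b∈i b∈k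
        with ∈-unmatched⁻ φ (bags d₂ i) b∈i | ∈-unmatched⁻ φ (bags d₂ k) b∈k
      ... | b∈i′ , φb≡nothing | b∈k′ , _ = ∈-unmatched⁺ φ (convex d₂ i≤j j≤k b∈i′ b∈k′) φb≡nothing

      part₁ : ℕ → Subset (order d₁)
      part₁ = splice m₁ (bags d₁) image-bags

      part₂ : ℕ → Subset (order d₂)
      part₂ = splice m₁ (const ∅) unmatched-bags

      convex-part₁ : Convex part₁
      convex-part₁ = convex-splice (convex d₁) (λ _ j≤k _ a∈k → image-down j≤k a∈k) bridge
        where
        bridge : ∀ {i k a} → i ≤ m₁ → a ∈ bags d₁ i → a ∈ image-bags k →
                 a ∈ bags d₁ m₁ × a ∈ image-bags 0
        bridge {k = k} _ _ a∈k with ∈-image⁻ φ (bags d₂ k) a∈k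
        ... | b , _ , φb≡a = proj₁ (proj₂ (matches φb≡a)) , image-down z≤n a∈k

      convex-part₂ : Convex part₂
      convex-part₂ = convex-splice convex-∅ convex-unmatched (λ _ v∈∅ _ → contradiction v∈∅ ∉⊥)

      bounded-part₁ : Bounded (suc m₁ + last d₂) part₁
      bounded-part₁ = splice-bounded λ {j} a∈ → bounded d₂ (proj₁ (proj₂ (∈-image⁻ φ (bags d₂ j) a∈)))

      bounded-part₂ : Bounded (suc m₁ + last d₂) part₂
      bounded-part₂ = splice-bounded λ {j} b∈ → bounded d₂ (proj₁ (∈-unmatched⁻ φ (bags d₂ j) b∈))

      thin-parts : ∀ {i} → Phase m₁ i → ∣ part₁ i ∣ + ∣ part₂ i ∣ ≤ suc (k₁ ⊔ k₂)
      thin-parts {i} (early i≤m₁) = begin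
        ∣ part₁ i ∣ + ∣ part₂ i ∣ ≡⟨ cong₂ _+_ (cong ∣_∣ (splice-early i≤m₁)) ∣part₂∣≡0 ⟩
        ∣ bags d₁ i ∣ + 0         ≡⟨ +-identityʳ _ ⟩
        ∣ bags d₁ i ∣             ≤⟨ thin d₁ i ⟩
        suc k₁                    ≤⟨ s≤s (m≤m⊔n k₁ k₂) ⟩
        suc (k₁ ⊔ k₂)             ∎
        where
        open ≤-Reasoning
        ∣part₂∣≡0 : ∣ part₂ i ∣ ≡ 0
        ∣part₂∣≡0 = trans (cong ∣_∣ (splice-early i≤m₁)) (∣⊥∣≡0 (order d₂))
      thin-parts (late j) = begin
        ∣ part₁ (suc m₁ + j) ∣ + ∣ part₂ (suc m₁ + j) ∣
          ≡⟨ cong₂ (λ p q → ∣ p ∣ + ∣ q ∣) (splice-late j) (splice-late j) ⟩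
        ∣ image-bags j ∣ + ∣ unmatched-bags j ∣
          ≤⟨ ∣image∣+∣unmatched∣≤∣p∣ φ (bags d₂ j) ⟩
        ∣ bags d₂ j ∣
          ≤⟨ thin d₂ j ⟩
        suc k₂
          ≤⟨ s≤s (m≤n⊔m k₁ k₂) ⟩
        suc (k₁ ⊔ k₂) ∎
        where open ≤-Reasoning

      thin-glued : ∀ i → ∣ part₁ i ++ part₂ i ∣ ≤ suc (k₁ ⊔ k₂)
      thin-glued i =
        ≤-trans (≤-reflexive (∣p++q∣≡∣p∣+∣q∣ (part₁ i) (part₂ i))) (thin-parts (phase m₁ i))

    vertex₂ : Fin (order d₂) → Fin (order d₁ + order d₂)
    vertex₂ b = maybe′ (_↑ˡ order d₂) (order d₁ ↑ʳ b) (φ b)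

    vertex₂-matched : ∀ {b a} → φ b ≡ just a → vertex₂ b ≡ a ↑ˡ order d₂
    vertex₂-matched φb≡a rewrite φb≡a = refl

    private
      label-vertex₂ : ∀ b → lookup (label d₁ ++ label d₂) (vertex₂ b) ≡ lookup (label d₂) b
      label-vertex₂ b with φ b in φb≡
      ... | just a = trans (lookup-++ˡ (label d₁) (label d₂) a) (proj₂ (proj₂ (matches φb≡)))
      ... | nothing = lookup-++ʳ (label d₁) (label d₂) b

      bags-vertex₂ : ∀ {j b} → b ∈ bags d₂ j → vertex₂ b ∈ part₁ (suc m₁ + j) ++ part₂ (suc m₁ + j)
      bags-vertex₂ {j} {b} b∈ with φ b in φb≡
      ... | just a = ∈-++ˡ⁺ (part₂ _) (splice-late⁺ (∈-image⁺ φ b∈ φb≡))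
      ... | nothing = ∈-++ʳ⁺ (part₁ _) (splice-late⁺ (∈-unmatched⁺ φ b∈ φb≡))

    glued : Decomposed (k₁ ⊔ k₂)
    glued = record
      { order = order d₁ + order d₂
      ; label = label d₁ ++ label d₂
      ; last = suc m₁ + last d₂
      ; bags = λ i → part₁ i ++ part₂ i
      ; convex = convex-++ convex-part₁ convex-part₂
      ; bounded = bounded-++ bounded-part₁ bounded-part₂
      ; thin = thin-glued
      ; src = src d₁ ↑ˡ order d₂
      ; tgt = vertex₂ (tgt d₂)
      ; src∈first = ∈-++ˡ⁺ (part₂ 0) (splice-early⁺ z≤n (src∈first d₁))
      ; tgt∈last = bags-vertex₂ (tgt∈last d₂)
      }

    embed₁ : Embedding d₁ glued
    embed₁ = record
      { vertex = _↑ˡ order d₂ ; time = id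
      ; label-vertex = lookup-++ˡ (label d₁) (label d₂)
      ; bags-vertex = λ v∈ → ∈-++ˡ⁺ (part₂ _) (splice-early⁺ (bounded d₁ v∈) v∈)
      }

    embed₂ : Embedding d₂ glued
    embed₂ = record
      { vertex = vertex₂ ; time = suc m₁ +_
      ; label-vertex = label-vertex₂
      ; bags-vertex = bags-vertex₂
      }

  record Witness (k : ℕ) (t : Term Σ) (x y : A) : Set where
    field
      decomposed : Decomposed k
      src-label  : lookup (label decomposed) (src decomposed) ≡ x
      tgt-label  : lookup (label decomposed) (tgt decomposed) ≡ y
      holds      : ⟦ t ⟧ (graph decomposed) (src decomposed) (tgt decomposed)

  open Witness

  relax : ∀ {k k′} → k ≤ k′ → Decomposed k → Decomposed k′
  relax k≤k′ d = record
    { order = order d ; label = label d ; last = last d ; bags = bags d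
    ; convex = convex d ; bounded = bounded d ; thin = λ i → ≤-trans (thin d i) (s≤s k≤k′)
    ; src = src d ; tgt = tgt d ; src∈first = src∈first d ; tgt∈last = tgt∈last d
    }

  weaken : ∀ {k k′ t x y} → k ≤ k′ → Witness k t x y → Witness k′ t x y
  weaken k≤k′ w = record
    { decomposed = relax k≤k′ (decomposed w)
    ; src-label = src-label w ; tgt-label = tgt-label w ; holds = holds w
    }

  Entails : Term Σ → Term Σ → Set₁
  Entails t u = ∀ {B} (T : Structure Σ B) {x y} → ⟦ t ⟧ T x y → ⟦ u ⟧ T x y

  entail : ∀ {k t u x y} → Entails t u → Witness k t x y → Witness k u x y
  entail t⇒u w = record
    { decomposed = decomposed w
    ; src-label = src-label w ; tgt-label = tgt-label w
    ; holds = t⇒u (graph (decomposed w)) (holds w)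
    }

  point-witness : ∀ k x → Witness k one x x
  point-witness k x = record
    { decomposed = flat (x ∷ []) (s≤s z≤n) zero zero
    ; src-label = refl ; tgt-label = refl ; holds = refl
    }

  edge : A → A → Decomposed 1
  edge x y = flat (x ∷ y ∷ []) ≤-refl zero (suc zero)

  edge-adjacent : ∀ x y → Adjacent (edge x y) zero (suc zero)
  edge-adjacent x y = 0 , splice-early⁺ z≤n ∈⊤ , splice-early⁺ z≤n ∈⊤

  converse : ∀ {k t x y} → Witness k t x y → Witness k (t ˘) y x
  converse {t = t} w = record
    { decomposed = reverse (decomposed w)
    ; src-label = tgt-label w ; tgt-label = src-label w
    ; holds = transport (reverse-embedding (decomposed w)) t (holds w)
    }

  sequence : ∀ {k₁ k₂ t u v x y z} → Witness k₁ t x z → Witness k₂ u z y →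
             (∀ {B} (T : Structure Σ B) {a b c} → ⟦ t ⟧ T a b → ⟦ u ⟧ T b c → ⟦ v ⟧ T a c) →
             Witness (k₁ ⊔ k₂) v x y
  sequence {k₁} {k₂} {t} {u} w₁ w₂ compose = record
    { decomposed = glued
    ; src-label = trans (label-vertex embed₁ (src d₁)) (src-label w₁)
    ; tgt-label = trans (label-vertex embed₂ (tgt d₂)) (tgt-label w₂)
    ; holds = compose (graph glued) (transport embed₁ t (holds w₁))
        (subst (λ w → ⟦ u ⟧ (graph glued) w (tgt glued))
          (vertex₂-matched (assoc-head {b = src d₂} []))
          (transport embed₂ u (holds w₂)))
    }
    where
    d₁ : Decomposed k₁
    d₁ = decomposed w₁

    d₂ : Decomposed k₂
    d₂ = decomposed w₂

    open Glue d₁ d₂ ((src d₂ , tgt d₁) ∷ [])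
      ((src∈first d₂ , tgt∈last d₁ , trans (tgt-label w₁) (sym (src-label w₂))) ∷ [])

  -- Widening puts the source of d₁ into its last bag and the target of d₂ into its first bag, so
  -- both endpoints of d₂ can be glued to those of d₁. If d₂ is a loop its endpoints are glued to
  -- the same vertex, which is consistent only when d₁ is a loop as well.
  parallel : ∀ {k₁ k₂ t u x y} (w₁ : Witness k₁ t x y) (w₂ : Witness k₂ u x y) →
             (src (decomposed w₂) ≡ tgt (decomposed w₂) → src (decomposed w₁) ≡ tgt (decomposed w₁)) →
             Witness (suc k₁ ⊔ suc k₂) (t ⊓ u) x y
  parallel {k₁} {k₂} {t} {u} w₁ w₂ loop₂⇒loop₁ = record
    { decomposed = glued
    ; src-label = trans (label-vertex embed₁ (src d₁)) (src-label w₁)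
    ; tgt-label = trans (label-vertex embed₂ (tgt d₂)) (tgt-label w₂)
    ; holds = subst (⟦ t ⟧ (graph glued) (src glued)) (sym (vertex₂-matched tgt-port))
                (transport embed₁ t (transport (widen-embedding (decomposed w₁) _) t (holds w₁))) ,
              subst (λ w → ⟦ u ⟧ (graph glued) w (tgt glued)) (vertex₂-matched (assoc-head ports′))
                (transport embed₂ u (transport (widen-embedding (decomposed w₂) _) u (holds w₂)))
    }
    where
    d₁ : Decomposed (suc k₁)
    d₁ = widen (decomposed w₁) (src (decomposed w₁))

    d₂ : Decomposed (suc k₂)
    d₂ = widen (decomposed w₂) (tgt (decomposed w₂))

    ports′ ports : List (Fin (order d₂) × Fin (order d₁))
    ports′ = (tgt d₂ , tgt d₁) ∷ []
    ports = (src d₂ , src d₁) ∷ ports′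

    tgt-port : assoc ports (tgt d₂) ≡ just (tgt d₁)
    tgt-port with tgt d₂ ≟ src d₂
    ... | yes tgt≡src = begin
      assoc ports (tgt d₂) ≡⟨ cong (assoc ports) tgt≡src ⟩
      assoc ports (src d₂) ≡⟨ assoc-head ports′ ⟩
      just (src d₁)        ≡⟨ cong just (loop₂⇒loop₁ (sym tgt≡src)) ⟩
      just (tgt d₁)        ∎
      where open ≡-Reasoning
    ... | no tgt≢src = trans (assoc-tail ports′ tgt≢src) (assoc-head [])

    open Glue d₁ d₂ ports
      ( (src∈first d₂ , ∈-widen (decomposed w₁) _ ≤-refl ,
         trans (src-label w₁) (sym (src-label w₂)))
      ∷ (∈-widen (decomposed w₂) _ z≤n , tgt∈last d₁ ,
         trans (tgt-label w₁) (sym (tgt-label w₂)))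
      ∷ [])

  intersection : ∀ {k₁ k₂ t u x y} → 1 ≤ k₁ → 1 ≤ k₂ →
                 Witness k₁ t x y → Witness k₂ u x y → Witness (k₁ + k₂) (t ⊓ u) x y
  intersection {k₁} {k₂} 1≤k₁ 1≤k₂ w₁ w₂
    with src (decomposed w₁) ≟ tgt (decomposed w₁) | src (decomposed w₂) ≟ tgt (decomposed w₂)
  ... | yes loop₁ | _ = weaken (suc⊔suc≤+ 1≤k₁ 1≤k₂) (parallel w₁ w₂ (const loop₁))
  ... | no _ | no ¬loop₂ =
    weaken (suc⊔suc≤+ 1≤k₁ 1≤k₂) (parallel w₁ w₂ (λ loop₂ → contradiction loop₂ ¬loop₂))
  ... | no _ | yes loop₂ =
    weaken (≤-trans (≤-reflexive (⊔-comm (suc k₂) (suc k₁))) (suc⊔suc≤+ 1≤k₁ 1≤k₂))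
      (entail (λ _ → swap) (parallel w₂ w₁ (const loop₂)))

  realise-star : ∀ {t} → (∀ {x y} → ⟦ t ⟧ S x y → Witness (iw t) t x y) →
                 ∀ {x y} → Star (⟦ t ⟧ S) x y → Witness (iw t) (t ⋆) x y
  realise-star {t} realise-t {x} ε = entail (λ _ → λ { refl → ε }) (point-witness (iw t) x)
  realise-star {t} realise-t (p ◅ ps) =
    weaken (≤-reflexive (⊔-idem (iw t)))
      (sequence (realise-t p) (realise-star realise-t ps) (λ _ → _◅_))

  realise : ∀ t {x y} → ⟦ t ⟧ S x y → Witness (iw t) t x y
  realise (var a) {x} {y} xy = record
    { decomposed = edge x y ; src-label = refl ; tgt-label = refl
    ; holds = xy , edge-adjacent x y
    }
  realise one {x} refl = point-witness 1 x
  realise top {x} {y} _ = record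
    { decomposed = edge x y ; src-label = refl ; tgt-label = refl ; holds = tt }
  realise (t ⨾ u) (z , p , q) = sequence (realise t p) (realise u q) (λ _ p q → _ , p , q)
  realise (t ⊕ u) (inj₁ p) = weaken (m≤m⊔n (iw t) (iw u)) (entail (λ _ → inj₁) (realise t p))
  realise (t ⊕ u) (inj₂ q) = weaken (m≤n⊔m (iw t) (iw u)) (entail (λ _ → inj₂) (realise u q))
  realise (t ⊓ u) (p , q) = intersection (1≤iw t) (1≤iw u) (realise t p) (realise u q)
  realise (t ˘) p = converse (realise t p)
  realise (t ⋆) p = realise-star (realise t) p

  -- A vertex v in no bag gets the singleton bag at position suc last + toℕ v.
  pw≤-graph : ∀ {k} (d : Decomposed k) → pw≤ (graph d) k
  pw≤-graph {k} d = pw≤-fromBags positions B convex-B thin-B covered joined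
    where
    positions : ℕ
    positions = suc (last d) + order d

    Alive : Fin (order d) → Set
    Alive v = ∃[ i ] v ∈ bags d i

    alive? : ∀ v → Dec (Alive v)
    alive? v = map′ (λ (i , v∈) → toℕ i , v∈)
      (λ (i , v∈) → fromℕ< (s≤s (bounded d v∈)) , subst (λ j → v ∈ bags d j) (sym (toℕ-fromℕ< _)) v∈)
      (any? (λ (i : Fin (suc (last d))) → v ∈? bags d (toℕ i)))

    isolated? : ∀ j → Decidable (λ v → toℕ v ≡ j × ¬ Alive v)
    isolated? j v = (toℕ v ≟ℕ j) ×-dec ¬? (alive? v)

    isolated : ℕ → Subset (order d)
    isolated j = select (isolated? j)

    isolated⁻ : ∀ {j v} → v ∈ isolated j → toℕ v ≡ j × ¬ Alive v
    isolated⁻ {j} = ∈-select⁻ (isolated? j)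

    isolated-unique : ∀ {j u v} → u ∈ isolated j → v ∈ isolated j → u ≡ v
    isolated-unique u∈ v∈ = toℕ-injective (trans (proj₁ (isolated⁻ u∈)) (sym (proj₁ (isolated⁻ v∈))))

    convex-isolated : Convex isolated
    convex-isolated {i} {j} {k} {v} i≤j j≤k v∈i v∈k = subst (λ j → v ∈ isolated j) i≡j v∈i
      where
      k≡i : k ≡ i
      k≡i = trans (sym (proj₁ (isolated⁻ v∈k))) (proj₁ (isolated⁻ v∈i))
      i≡j : i ≡ j
      i≡j = ≤-antisym i≤j (≤-trans j≤k (≤-reflexive k≡i))

    B : ℕ → Subset (order d)
    B = splice (last d) (bags d) isolated

    convex-B : Convex B
    convex-B = convex-splice (convex d) convex-isolated
      (λ _ v∈ v∈isolated → contradiction (_ , v∈) (proj₂ (isolated⁻ v∈isolated)))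

    thin-B : ∀ i → ∣ B i ∣ ≤ suc k
    thin-B = splice-thin (λ {i} _ → thin d i)
      (λ j → ≤-trans (∣p∣≤1 (isolated j) isolated-unique) (s≤s z≤n))

    in-range : ∀ {i} → i ≤ last d → i < positions
    in-range i≤last = s≤s (≤-trans i≤last (m≤m+n (last d) (order d)))

    covered : ∀ v → ∃[ i ] i < positions × v ∈ B i
    covered v with alive? v
    ... | yes (i , v∈) = i , in-range (bounded d v∈) , splice-early⁺ (bounded d v∈) v∈
    ... | no dead = suc (last d) + toℕ v , +-monoʳ-< (suc (last d)) (toℕ<n v) ,
                    splice-late⁺ (∈-select⁺ (isolated? (toℕ v)) (refl , dead))

    joined : ∀ a u v → rel (graph d) a u v → ∃[ i ] i < positions × u ∈ B i × v ∈ B i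
    joined _ _ _ (_ , i , u∈ , v∈) =
      i , in-range (bounded d u∈) , splice-early⁺ (bounded d u∈) u∈ , splice-early⁺ (bounded d u∈) v∈

RELpw≤⇒REL : ∀ {Σ} (t s : Term Σ) → RELpw≤ iw t ⊨ t ≤ s → REL⊨ t ≤ s
RELpw≤⇒REL t s valid A S x y p =
  subst₂ (⟦ s ⟧ S) src-label tgt-label
    (homomorphism-preserves (label-homomorphism decomposed) s
      (valid (order decomposed) (graph decomposed) (pw≤-graph decomposed)
        (src decomposed) (tgt decomposed) holds))
  where
  open Realisation S
  open Decomposed
  open Witness (realise t p)

proposition2p10 : (Σ : Set) (t s : Term Σ) →
    (REL⊨ t ≤ s) ⇔ (RELpw≤ iw t ⊨ t ≤ s)
proposition2p10 Σ t s = mk⇔ (λ valid n S _ → valid (Fin n) S) (RELpw≤⇒REL t s)
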